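{- Let $n\ge 1$. The non-adaptive complexity of the problem $P_n(?\rightarrow 1)$ in the case of at most one lie is $2n+1$. That is: there is a multi-family of $2n+1$ subsets of $[n]=\{1,\dots,n\}$ that solves the problem $P_n(?\rightarrow 1)$ with at most one lie, and every multi-family of subsets of $[n]$ solving this problem has at least $2n+1$ members (counted with multiplicity).
   Context: Problem $P_n(?\rightarrow 1)$ with at most one lie: an unknown set $T\subseteq[n]$ of "excellent" elements is given (possibly empty, size unknown). A non-adaptive algorithm is a finite multi-family $\mathcal F$ of subsets of $[n]$ (a set may occur several times; $|\mathcal F|$ counts multiplicity). For each member $F$ of $\mathcal F$ (each copy separately) the question "does $F$ contain at least one excellent element, i.e. is $F\cap T\neq\emptyset$?" is asked, and answered YES or NO; all answers are correct with at most one exception. Given an answer sequence, call $T\subseteq[n]$ consistent if the number of members $F$ (counted with multiplicity) whose answer differs from the truth value of "$F\cap T\ne\emptyset$" is at most one. The multi-family $\mathcal F$ solves the problem if for every possible answer sequence, either there is an element $x\in[n]$ belonging to every consistent $T$ (an excellent element is found), or every consistent $T$ is empty (one can claim there is no excellent element). The non-adaptive complexity is the minimum of $|\mathcal F|$ over all multi-families $\mathcal F$ solving the problem. -}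

module Defs where

open import Data.Nat using (ℕ; zero; suc; _+_; _≤_)
open import Data.Bool using (Bool; true; false; if_then_else_)
open import Data.List using (List; []; _∷_; length)
open import Data.Vec using (Vec; []; _∷_)
open import Data.Fin using (Fin)
open import Data.Fin.Subset using (Subset; _∩_; _∈_; Empty)
open import Data.Fin.Subset.Properties using (nonempty?)
open import Data.Product using (∃)
open import Data.Sum using (_⊎_)
open import Relation.Nullary.Decidable using (isYes)
open import Relation.Binary.PropositionalEquality using (_≡_)
open import Data.Bool.Properties using () renaming (_≟_ to _≟ᵇ_)

-- A multi-family of subsets of [n] (multiplicity = repetition in the list).
Family : ℕ → Set
Family n = List (Subset n)

truth : ∀ {n} → Subset n → Subset n → Bool
truth F T = isYes (nonempty? (F ∩ T))

Answers : ∀ {n} → Family n → Set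
Answers 𝓕 = Vec Bool (length 𝓕)

mismatches : ∀ {n} (𝓕 : Family n) → Answers 𝓕 → Subset n → ℕ
mismatches []      []       T = 0
mismatches (F ∷ 𝓕) (a ∷ as) T =
  (if isYes (a ≟ᵇ truth F T) then 0 else 1) + mismatches 𝓕 as T

Consistent : ∀ {n} (𝓕 : Family n) → Answers 𝓕 → Subset n → Set
Consistent 𝓕 as T = mismatches 𝓕 as T ≤ 1

Solves : ∀ {n} → Family n → Set
Solves {n} 𝓕 = (as : Answers 𝓕) →
    (∃ λ (x : Fin n) → ∀ T → Consistent 𝓕 as T → x ∈ T)
  ⊎ (∀ T → Consistent 𝓕 as T → Empty T)

-- Lower bound: call the questions on which truthful answers for S and for T differ the
-- questions separating S from T.  If 𝓕 solves the problem for excellent sets inside A, at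
-- least 2|A| + 1 questions separate A from ∅.  For |A| = 1: with at most two of them, one lie
-- makes both A and ∅ consistent.  For |A| ≥ 2: under truthful answers for A, the solution must
-- name some x ∈ A, so A - x is inconsistent; hence for some k ∈ A at least two questions
-- separate A from A - k, and these are disjoint from those separating A - k from ∅.
--
-- Upper bound: ask ⊤ once and every singleton twice.  Two YES answers on ⁅ i ⁆ force i.
-- Otherwise, if ∅ is consistent, no consistent set has an element; if ∅ is not consistent,
-- some singleton got a YES, and its element lies in every consistent set, since a consistent
-- set missing it would have to contain some other element and pay a second lie there.
module Submission where

open import Defs
open import Data.Nat using (ℕ; _≤_; _+_; _*_)
open import Data.List using (length)
open import Data.Product using (_×_; ∃)
open import Relation.Binary.PropositionalEquality using (_≡_)

open import Algebra.Properties.CommutativeSemigroup using (interchange)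
open import Data.Bool using (Bool; true; false; if_then_else_)
open import Data.Bool.Properties using () renaming (_≟_ to _≟ᵇ_)
open import Data.Fin using (Fin; zero; suc)
open import Data.Fin.Properties using () renaming (any? to anyFin?)
open import Data.Fin.Subset
  using (Subset; inside; outside; _∩_; _∈_; _∉_; _⊆_; _-_; Empty; Nonempty; ⊤; ⊥; ⁅_⁆; ∣_∣)
open import Data.Fin.Subset.Properties
  using (nonempty?; _∈?_; x∈p∩q⁺; x∈p∩q⁻; x∈⁅x⁆; x∈⁅y⁆⇒x≡y; ∉⊥; ∈⊤; ⊆-refl; ⊆-min;
         p─q⊆p; p⊆q⇒∣p∣≤∣q∣; x∈p∧x≢y⇒x∈p-y; ∣⊥∣≡0; ∣⊤∣≡n; Empty-unique)
open import Data.List using (List; []; _∷_; map; allFin)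
open import Data.List.Membership.Propositional using (find) renaming (_∈_ to _∈ₗ_)
open import Data.List.Membership.Propositional.Properties using (∈-allFin)
open import Data.List.Properties using (length-tabulate)
open import Data.List.Relation.Unary.All using (All; []; _∷_; all?)
import Data.List.Relation.Unary.All as All
open import Data.List.Relation.Unary.All.Properties using (¬All⇒Any¬; ¬Any⇒All¬)
open import Data.List.Relation.Unary.Any using (here; there; any?)
open import Data.Nat using (zero; suc; z≤n; s≤s; pred; _≤?_)
open import Data.Nat.ListAction using (sum)
open import Data.Nat.Properties
  using (≤-refl; ≤-trans; ≤-reflexive; ≤-pred; ≰⇒>; pred-mono-≤; n≤1+n; m≤m+n; m≤n+m; m≤n⇒m≤o+n;
         +-mono-≤; +-monoʳ-≤; +-assoc; +-comm; +-suc; +-identityʳ; *-distribˡ-+;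
         +-commutativeSemigroup; module ≤-Reasoning)
open import Data.Product using (_,_; proj₁; proj₂)
import Data.Product as Product
open import Data.Product.Properties using (≡-dec)
open import Data.Sum using (_⊎_; inj₁; inj₂)
import Data.Sum as Sum
open import Data.Vec using ([]; _∷_; here; there)
open import Function using (_∘_; id)
open import Relation.Binary.PropositionalEquality
  using (refl; sym; trans; cong; cong₂; subst; subst₂; module ≡-Reasoning)
open import Relation.Nullary using (¬_; yes; no; contradiction)
open import Relation.Nullary.Decidable using (isYes; _×-dec_)
open import Relation.Unary using (Decidable)

private variable n : ℕ

mismatch : Bool → Bool → ℕ
mismatch a b = if isYes (a ≟ᵇ b) then 0 else 1

mismatch-self : ∀ a → mismatch a a ≡ 0
mismatch-self true  = refl
mismatch-self false = refl

mismatch-≡ : ∀ {a b} → a ≡ b → mismatch a b ≡ 0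
mismatch-≡ {a} refl = mismatch-self a

mismatch≤1 : ∀ a b → mismatch a b ≤ 1
mismatch≤1 true  true  = z≤n
mismatch≤1 true  false = ≤-refl
mismatch≤1 false true  = ≤-refl
mismatch≤1 false false = z≤n

mismatch-chain : ∀ a b c → (b ≡ true → a ≡ true) → (c ≡ true → b ≡ true) →
  mismatch a c ≡ mismatch a b + mismatch b c
mismatch-chain true  true  true  _   _   = refl
mismatch-chain true  true  false _   _   = refl
mismatch-chain true  false true  _   c⇒b = contradiction (c⇒b refl) λ ()
mismatch-chain true  false false _   _   = refl
mismatch-chain false true  _     b⇒a _   = contradiction (b⇒a refl) λ ()
mismatch-chain false false true  _   c⇒b = contradiction (c⇒b refl) λ ()
mismatch-chain false false false _   _   = refl

¬unanimous⇒1≤mismatches : {a b : Bool} (c : Bool) → ¬ (a , b) ≡ (c , c) → 1 ≤ mismatch a c + mismatch b c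
¬unanimous⇒1≤mismatches {true}  {true}  true  ¬u = contradiction refl ¬u
¬unanimous⇒1≤mismatches {true}  {false} true  _  = ≤-refl
¬unanimous⇒1≤mismatches {false} {_}     true  _  = s≤s z≤n
¬unanimous⇒1≤mismatches {true}  {_}     false _  = s≤s z≤n
¬unanimous⇒1≤mismatches {false} {true}  false _  = ≤-refl
¬unanimous⇒1≤mismatches {false} {false} false ¬u = contradiction refl ¬u

mismatches-against-false-and-true : ∀ a c d →
  (mismatch a false + (mismatch c false + mismatch d false)) + (mismatch a true + (mismatch c true + mismatch d true)) ≡ 3
mismatches-against-false-and-true true  true  true  = refl
mismatches-against-false-and-true true  true  false = refl
mismatches-against-false-and-true true  false true  = refl
mismatches-against-false-and-true true  false false = refl
mismatches-against-false-and-true false true  true  = refl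
mismatches-against-false-and-true false true  false = refl
mismatches-against-false-and-true false false true  = refl
mismatches-against-false-and-true false false false = refl

module _ {F T : Subset n} where

  truth≡true : Nonempty (F ∩ T) → truth F T ≡ true
  truth≡true ne with nonempty? (F ∩ T)
  ... | yes _  = refl
  ... | no ¬ne = contradiction ne ¬ne

  truth≡false : ¬ Nonempty (F ∩ T) → truth F T ≡ false
  truth≡false ¬ne with nonempty? (F ∩ T)
  ... | yes ne = contradiction ne ¬ne
  ... | no _   = refl

  truth≡true⇒nonempty : truth F T ≡ true → Nonempty (F ∩ T)
  truth≡true⇒nonempty eq with nonempty? (F ∩ T)
  ... | yes ne = ne

truth-mono : {F T S : Subset n} → T ⊆ S → truth F T ≡ true → truth F S ≡ true
truth-mono {F = F} {T} T⊆S eq =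
  let x , x∈F∩T = truth≡true⇒nonempty eq
      x∈F , x∈T = x∈p∩q⁻ F T x∈F∩T
  in truth≡true (x , x∈p∩q⁺ (x∈F , T⊆S x∈T))

truth-⊥ : (F : Subset n) → truth F ⊥ ≡ false
truth-⊥ F = truth≡false λ (x , x∈F∩⊥) → ∉⊥ (proj₂ (x∈p∩q⁻ F ⊥ x∈F∩⊥))

truth-⊤ : {T : Subset n} → Nonempty T → truth ⊤ T ≡ true
truth-⊤ (y , y∈T) = truth≡true (y , x∈p∩q⁺ (∈⊤ , y∈T))

truth-⁅⁆-∈ : {i : Fin n} {T : Subset n} → i ∈ T → truth ⁅ i ⁆ T ≡ true
truth-⁅⁆-∈ {i = i} i∈T = truth≡true (i , x∈p∩q⁺ (x∈⁅x⁆ i , i∈T))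

truth-⁅⁆-∉ : {i : Fin n} {T : Subset n} → i ∉ T → truth ⁅ i ⁆ T ≡ false
truth-⁅⁆-∉ {i = i} {T} i∉T = truth≡false λ (y , y∈⁅i⁆∩T) →
  let y∈⁅i⁆ , y∈T = x∈p∩q⁻ ⁅ i ⁆ T y∈⁅i⁆∩T
  in i∉T (subst (_∈ T) (x∈⁅y⁆⇒x≡y i y∈⁅i⁆) y∈T)

answersFor : (𝓕 : Family n) → Subset n → Answers 𝓕
answersFor []      T = []
answersFor (F ∷ 𝓕) T = truth F T ∷ answersFor 𝓕 T

separating : Family n → Subset n → Subset n → ℕ
separating 𝓕 S T = mismatches 𝓕 (answersFor 𝓕 S) T

separating-self : (𝓕 : Family n) (T : Subset n) → separating 𝓕 T T ≡ 0
separating-self []      T = refl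
separating-self (F ∷ 𝓕) T rewrite mismatch-self (truth F T) = separating-self 𝓕 T

mismatches≤length : (𝓕 : Family n) (as : Answers 𝓕) (T : Subset n) → mismatches 𝓕 as T ≤ length 𝓕
mismatches≤length []      []       T = z≤n
mismatches≤length (F ∷ 𝓕) (a ∷ as) T = +-mono-≤ (mismatch≤1 a (truth F T)) (mismatches≤length 𝓕 as T)

separating-chain : (𝓕 : Family n) {S T R : Subset n} → R ⊆ T → T ⊆ S →
  separating 𝓕 S R ≡ separating 𝓕 S T + separating 𝓕 T R
separating-chain []      R⊆T T⊆S = refl
separating-chain (F ∷ 𝓕) {S} {T} {R} R⊆T T⊆S = begin
  mismatch (truth F S) (truth F R) + separating 𝓕 S R
    ≡⟨ cong₂ _+_ (mismatch-chain _ _ _ (truth-mono T⊆S) (truth-mono R⊆T)) (separating-chain 𝓕 R⊆T T⊆S) ⟩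
  (mismatch (truth F S) (truth F T) + mismatch (truth F T) (truth F R)) + (separating 𝓕 S T + separating 𝓕 T R)
    ≡⟨ interchange +-commutativeSemigroup (mismatch (truth F S) (truth F T)) _ (separating 𝓕 S T) _ ⟩
  (mismatch (truth F S) (truth F T) + separating 𝓕 S T) + (mismatch (truth F T) (truth F R) + separating 𝓕 T R) ∎
  where open ≡-Reasoning

halfway : (𝓕 : Family n) → Subset n → Subset n → Answers 𝓕
halfway []      S T = []
halfway (F ∷ 𝓕) S T with truth F S ≟ᵇ truth F T
... | yes _ = truth F S ∷ halfway 𝓕 S T
... | no _  = truth F T ∷ answersFor 𝓕 S

halfway-lies≤1 : (𝓕 : Family n) (S T : Subset n) → mismatches 𝓕 (halfway 𝓕 S T) S ≤ 1
halfway-lies≤1 []      S T = z≤n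
halfway-lies≤1 (F ∷ 𝓕) S T with truth F S ≟ᵇ truth F T
... | yes _ = subst (_≤ 1) (cong (_+ _) (sym (mismatch-self (truth F S)))) (halfway-lies≤1 𝓕 S T)
... | no _  = +-mono-≤ (mismatch≤1 (truth F T) (truth F S)) (≤-reflexive (separating-self 𝓕 S))

halfway-lies≤pred : (𝓕 : Family n) (S T : Subset n) →
  mismatches 𝓕 (halfway 𝓕 S T) T ≤ pred (separating 𝓕 S T)
halfway-lies≤pred []      S T = z≤n
halfway-lies≤pred (F ∷ 𝓕) S T with truth F S ≟ᵇ truth F T
... | yes eq = subst (_≤ pred (separating 𝓕 S T)) (cong (_+ _) (sym (mismatch-≡ eq))) (halfway-lies≤pred 𝓕 S T)
... | no _  = ≤-reflexive (cong (_+ _) (mismatch-self (truth F T)))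

SolvesWithin : Subset n → Family n → Set
SolvesWithin {n} A 𝓕 = (as : Answers 𝓕) →
    (∃ λ (x : Fin n) → ∀ T → T ⊆ A → Consistent 𝓕 as T → x ∈ T)
  ⊎ (∀ T → T ⊆ A → Consistent 𝓕 as T → Empty T)

solves⇒solvesWithin : (𝓕 : Family n) (A : Subset n) → Solves 𝓕 → SolvesWithin A 𝓕
solves⇒solvesWithin 𝓕 A solves as =
  Sum.map (Product.map₂ λ found T _ → found T) (λ none T _ → none T) (solves as)

solvesWithin-⊆ : (𝓕 : Family n) {A B : Subset n} → B ⊆ A → SolvesWithin A 𝓕 → SolvesWithin B 𝓕
solvesWithin-⊆ 𝓕 B⊆A solves as =
  Sum.map (Product.map₂ λ found T T⊆B → found T (B⊆A ∘ T⊆B)) (λ none T T⊆B → none T (B⊆A ∘ T⊆B)) (solves as)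

¬solvesWithin-if-A-and-⊥-consistent : (𝓕 : Family n) {A : Subset n} (as : Answers 𝓕) → Nonempty A →
  Consistent 𝓕 as A → Consistent 𝓕 as ⊥ → ¬ SolvesWithin A 𝓕
¬solvesWithin-if-A-and-⊥-consistent 𝓕 {A} as ne-A A-ok ⊥-ok solves with solves as
... | inj₁ (x , found) = ∉⊥ (found ⊥ (⊆-min A) ⊥-ok)
... | inj₂ none        = none A ⊆-refl A-ok ne-A

3≤separating-from-⊥ : (𝓕 : Family n) {A : Subset n} → SolvesWithin A 𝓕 → Nonempty A →
  3 ≤ separating 𝓕 A ⊥
3≤separating-from-⊥ 𝓕 {A} solves ne-A with 3 ≤? separating 𝓕 A ⊥
... | yes 3≤sep = 3≤sep
... | no  3≰sep = contradiction solves
  (¬solvesWithin-if-A-and-⊥-consistent 𝓕 (halfway 𝓕 A ⊥) ne-A (halfway-lies≤1 𝓕 A ⊥)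
    (≤-trans (halfway-lies≤pred 𝓕 A ⊥) (pred-mono-≤ (≤-pred (≰⇒> 3≰sep)))))

1≤∣p∣⇒nonempty : {p : Subset n} → 1 ≤ ∣ p ∣ → Nonempty p
1≤∣p∣⇒nonempty {n} {p} 1≤∣p∣ with nonempty? p
... | yes ne  = ne
... | no  ¬ne with ≤-trans 1≤∣p∣ (≤-reflexive (trans (cong ∣_∣ (Empty-unique ¬ne)) (∣⊥∣≡0 n)))
...   | ()

x∉p-x : (p : Subset n) (x : Fin n) → x ∉ p - x
x∉p-x (b ∷ p) zero    ()
x∉p-x (b ∷ p) (suc x) (there x∈p-x) = x∉p-x p x x∈p-x

∣p∣≤1+∣p-x∣ : (p : Subset n) (x : Fin n) → ∣ p ∣ ≤ suc ∣ p - x ∣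
∣p∣≤1+∣p-x∣ (b ∷ p) zero = ≤-trans (∣b∷p∣≤1+∣p∣ b) (s≤s (p⊆q⇒∣p∣≤∣q∣ p⊆[b∷p]-0))
  where
  ∣b∷p∣≤1+∣p∣ : ∀ b → ∣ b ∷ p ∣ ≤ suc ∣ p ∣
  ∣b∷p∣≤1+∣p∣ inside  = ≤-refl
  ∣b∷p∣≤1+∣p∣ outside = n≤1+n ∣ p ∣
  p⊆[b∷p]-0 : outside ∷ p ⊆ (b ∷ p) - zero
  p⊆[b∷p]-0 (there y∈p) = x∈p∧x≢y⇒x∈p-y {p = b ∷ p} {y = zero} (there y∈p) λ ()
∣p∣≤1+∣p-x∣ (inside  ∷ p) (suc x) = s≤s (∣p∣≤1+∣p-x∣ p x)
∣p∣≤1+∣p-x∣ (outside ∷ p) (suc x) = ∣p∣≤1+∣p-x∣ p x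

¬solvesWithin-if-punctures-consistent : (𝓕 : Family n) {A : Subset n} → 2 ≤ ∣ A ∣ →
  (∀ k → k ∈ A → Consistent 𝓕 (answersFor 𝓕 A) (A - k)) → ¬ SolvesWithin A 𝓕
¬solvesWithin-if-punctures-consistent 𝓕 {A} 2≤∣A∣ punctures-ok solves with solves (answersFor 𝓕 A)
... | inj₁ (x , found) =
  let x∈A = found A ⊆-refl (≤-trans (≤-reflexive (separating-self 𝓕 A)) z≤n)
  in x∉p-x A x (found (A - x) (p─q⊆p A ⁅ x ⁆) (punctures-ok x x∈A))
... | inj₂ none =
  let k , k∈A = 1≤∣p∣⇒nonempty (≤-trans (s≤s z≤n) 2≤∣A∣)
  in none (A - k) (p─q⊆p A ⁅ k ⁆) (punctures-ok k k∈A)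
       (1≤∣p∣⇒nonempty (≤-pred (≤-trans 2≤∣A∣ (∣p∣≤1+∣p-x∣ A k))))

∃-puncture-separated-twice : (𝓕 : Family n) {A : Subset n} → 2 ≤ ∣ A ∣ → SolvesWithin A 𝓕 →
  ∃ λ k → k ∈ A × 2 ≤ separating 𝓕 A (A - k)
∃-puncture-separated-twice 𝓕 {A} 2≤∣A∣ solves
  with anyFin? (λ k → (k ∈? A) ×-dec (2 ≤? separating 𝓕 A (A - k)))
... | yes found = found
... | no  ¬found = contradiction solves (¬solvesWithin-if-punctures-consistent 𝓕 2≤∣A∣ punctures-ok)
  where
  punctures-ok : ∀ k → k ∈ A → separating 𝓕 A (A - k) ≤ 1
  punctures-ok k k∈A with 2 ≤? separating 𝓕 A (A - k)
  ... | yes 2≤sep = contradiction (k , k∈A , 2≤sep) ¬found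
  ... | no  2≰sep = ≤-pred (≰⇒> 2≰sep)

2[1+s]+1≤separating-from-⊥ : (s : ℕ) (𝓕 : Family n) {A : Subset n} → suc s ≤ ∣ A ∣ → SolvesWithin A 𝓕 →
  2 * suc s + 1 ≤ separating 𝓕 A ⊥
2[1+s]+1≤separating-from-⊥ zero    𝓕 1≤∣A∣ solves = 3≤separating-from-⊥ 𝓕 solves (1≤∣p∣⇒nonempty 1≤∣A∣)
2[1+s]+1≤separating-from-⊥ (suc s) 𝓕 {A} 2+s≤∣A∣ solves = begin
  2 * suc (suc s) + 1                          ≡⟨ cong (_+ 1) (*-distribˡ-+ 2 1 (suc s)) ⟩
  2 + 2 * suc s + 1                            ≡⟨ +-assoc 2 (2 * suc s) 1 ⟩
  2 + (2 * suc s + 1)                          ≤⟨ +-mono-≤ 2≤sep IH ⟩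
  separating 𝓕 A (A - k) + separating 𝓕 (A - k) ⊥ ≡⟨ separating-chain 𝓕 (⊆-min (A - k)) A-k⊆A ⟨
  separating 𝓕 A ⊥                             ∎
  where
  open ≤-Reasoning
  puncture = ∃-puncture-separated-twice 𝓕 (≤-trans (s≤s (s≤s z≤n)) 2+s≤∣A∣) solves
  k = proj₁ puncture
  2≤sep = proj₂ (proj₂ puncture)
  A-k⊆A = p─q⊆p A ⁅ k ⁆
  IH = 2[1+s]+1≤separating-from-⊥ s 𝓕 (≤-pred (≤-trans 2+s≤∣A∣ (∣p∣≤1+∣p-x∣ A k))) (solvesWithin-⊆ 𝓕 A-k⊆A solves)

solves⇒2n+1≤length : (𝓕 : Family n) → 1 ≤ n → Solves 𝓕 → 2 * n + 1 ≤ length 𝓕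
solves⇒2n+1≤length {suc m} 𝓕 _ solves =
  ≤-trans (2[1+s]+1≤separating-from-⊥ m 𝓕 (≤-reflexive (sym (∣⊤∣≡n (suc m)))) (solves⇒solvesWithin 𝓕 ⊤ solves))
          (mismatches≤length 𝓕 (answersFor 𝓕 ⊤) ⊥)

∈⇒≤sum : {A : Set} (f : A → ℕ) {x : A} {xs : List A} → x ∈ₗ xs → f x ≤ sum (map f xs)
∈⇒≤sum f (here refl)                 = m≤m+n _ _
∈⇒≤sum f {xs = y ∷ xs} (there x∈xs) = m≤n⇒m≤o+n (f y) (∈⇒≤sum f x∈xs)

sum-map-≡0 : {A : Set} {f : A → ℕ} {xs : List A} → All (λ x → f x ≡ 0) xs → sum (map f xs) ≡ 0
sum-map-≡0 []           = refl
sum-map-≡0 (fx≡0 ∷ all) rewrite fx≡0 = sum-map-≡0 all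

∈∧∈∧≢⇒+≤sum : {A : Set} (f : A → ℕ) {x y : A} {xs : List A} → x ∈ₗ xs → y ∈ₗ xs → ¬ x ≡ y →
  f x + f y ≤ sum (map f xs)
∈∧∈∧≢⇒+≤sum f (here refl)  (here refl)  x≢y = contradiction refl x≢y
∈∧∈∧≢⇒+≤sum f {x} (here refl) (there y∈xs) _ = +-monoʳ-≤ (f x) (∈⇒≤sum f y∈xs)
∈∧∈∧≢⇒+≤sum f {x} {y} {y ∷ xs} (there x∈xs) (here refl) _ =
  subst (_≤ f y + sum (map f xs)) (+-comm (f y) (f x)) (+-monoʳ-≤ (f y) (∈⇒≤sum f x∈xs))
∈∧∈∧≢⇒+≤sum f {xs = z ∷ xs} (there x∈xs) (there y∈xs) x≢y =
  m≤n⇒m≤o+n (f z) (∈∧∈∧≢⇒+≤sum f x∈xs y∈xs x≢y)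

doubledSingletons : List (Fin n) → Family n
doubledSingletons []       = []
doubledSingletons (i ∷ is) = ⁅ i ⁆ ∷ ⁅ i ⁆ ∷ doubledSingletons is

witnessFamily : (n : ℕ) → Family n
witnessFamily n = ⊤ ∷ doubledSingletons (allFin n)

length-doubledSingletons : (is : List (Fin n)) → length (doubledSingletons is) ≡ length is + length is
length-doubledSingletons []       = refl
length-doubledSingletons (i ∷ is) = cong suc (begin
  suc (length (doubledSingletons is))  ≡⟨ cong suc (length-doubledSingletons is) ⟩
  suc (length is + length is)          ≡⟨ +-suc (length is) (length is) ⟨
  length is + suc (length is)          ∎)
  where open ≡-Reasoning

length-witnessFamily : (n : ℕ) → length (witnessFamily n) ≡ 2 * n + 1
length-witnessFamily n = begin
  suc (length (doubledSingletons (allFin n)))  ≡⟨ cong suc (length-doubledSingletons (allFin n)) ⟩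
  suc (length (allFin n) + length (allFin n))  ≡⟨ cong (λ m → suc (m + m)) (length-tabulate {n = n} (id {A = Fin n})) ⟩
  suc (n + n)                                  ≡⟨ +-comm 1 (n + n) ⟩
  n + n + 1                                    ≡⟨ cong (λ m → n + m + 1) (+-identityʳ n) ⟨
  2 * n + 1                                    ∎
  where open ≡-Reasoning

Ballot : ℕ → Set
Ballot n = Fin n × Bool × Bool

ballots : (is : List (Fin n)) → Answers (doubledSingletons is) → List (Ballot n)
ballots []       []           = []
ballots (i ∷ is) (a ∷ b ∷ bs) = (i , a , b) ∷ ballots is bs

ballot-∈ : {i : Fin n} (is : List (Fin n)) (bs : Answers (doubledSingletons is)) → i ∈ₗ is →
  ∃ λ a → ∃ λ b → (i , a , b) ∈ₗ ballots is bs
ballot-∈ (i ∷ is) (a ∷ b ∷ bs) (here refl)  = a , b , here refl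
ballot-∈ (j ∷ is) (a ∷ b ∷ bs) (there i∈is) = Product.map₂ (Product.map₂ there) (ballot-∈ is bs i∈is)

ballotLies : Subset n → Ballot n → ℕ
ballotLies T (i , a , b) = mismatch a (truth ⁅ i ⁆ T) + mismatch b (truth ⁅ i ⁆ T)

mismatches-doubledSingletons : (is : List (Fin n)) (bs : Answers (doubledSingletons is)) (T : Subset n) →
  mismatches (doubledSingletons is) bs T ≡ sum (map (ballotLies T) (ballots is bs))
mismatches-doubledSingletons []       []           T = refl
mismatches-doubledSingletons (i ∷ is) (a ∷ b ∷ bs) T =
  trans (sym (+-assoc (mismatch a (truth ⁅ i ⁆ T)) _ _))
        (cong (ballotLies T (i , a , b) +_) (mismatches-doubledSingletons is bs T))

Unanimous : Bool → Ballot n → Set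
Unanimous c (i , a , b) = (a , b) ≡ (c , c)

unanimous? : (c : Bool) → Decidable (Unanimous {n} c)
unanimous? c (i , a , b) = ≡-dec _≟ᵇ_ _≟ᵇ_ (a , b) (c , c)

module WitnessFamilyDecoding {n : ℕ} (a₀ : Bool) (bs : Answers (doubledSingletons (allFin n))) where

  votes : List (Ballot n)
  votes = ballots (allFin n) bs

  lies : Subset n → ℕ
  lies = mismatches (witnessFamily n) (a₀ ∷ bs)

  vote : (i : Fin n) → ∃ λ a → ∃ λ b → (i , a , b) ∈ₗ votes
  vote i = ballot-∈ (allFin n) bs (∈-allFin i)

  lies≡ : (T : Subset n) → lies T ≡ mismatch a₀ (truth ⊤ T) + sum (map (ballotLies T) votes)
  lies≡ T = cong (mismatch a₀ (truth ⊤ T) +_) (mismatches-doubledSingletons (allFin n) bs T)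

  head+ballot≤lies : (T : Subset n) {v : Ballot n} → v ∈ₗ votes →
    mismatch a₀ (truth ⊤ T) + ballotLies T v ≤ lies T
  head+ballot≤lies T v∈ =
    ≤-trans (+-monoʳ-≤ (mismatch a₀ (truth ⊤ T)) (∈⇒≤sum (ballotLies T) v∈)) (≤-reflexive (sym (lies≡ T)))

  two-ballots≤lies : (T : Subset n) {v w : Ballot n} → v ∈ₗ votes → w ∈ₗ votes → ¬ v ≡ w →
    ballotLies T v + ballotLies T w ≤ lies T
  two-ballots≤lies T v∈ w∈ v≢w =
    ≤-trans (m≤n⇒m≤o+n (mismatch a₀ (truth ⊤ T)) (∈∧∈∧≢⇒+≤sum (ballotLies T) v∈ w∈ v≢w))
            (≤-reflexive (sym (lies≡ T)))

  unanimous-yes⇒∈ : {i : Fin n} (T : Subset n) → (i , true , true) ∈ₗ votes → lies T ≤ 1 → i ∈ T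
  unanimous-yes⇒∈ {i} T v∈ T-ok with i ∈? T
  ... | yes i∈T = i∈T
  ... | no  i∉T = contradiction (≤-trans 2≤lies T-ok) λ { (s≤s ()) }
    where
    2≤lies : 2 ≤ lies T
    2≤lies = ≤-trans (subst (λ t → 2 ≤ mismatch true t + mismatch true t) (sym (truth-⁅⁆-∉ i∉T)) ≤-refl)
                     (≤-trans (m≤n+m _ (mismatch a₀ (truth ⊤ T))) (head+ballot≤lies T v∈))

  -- ⊤ and both copies of ⁅ y ⁆ separate a set containing y from ⊥, so the two cannot both be
  -- within one lie of the answers.
  ⊥-consistent⇒empty : (T : Subset n) → lies ⊥ ≤ 1 → lies T ≤ 1 → Empty T
  ⊥-consistent⇒empty T ⊥-ok T-ok (y , y∈T) =
    let c , d , v∈ = vote y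
        lies-⊥ = subst₂ (λ t u → mismatch a₀ t + (mismatch c u + mismatch d u) ≤ lies ⊥)
                   (truth-⊥ ⊤) (truth-⊥ ⁅ y ⁆) (head+ballot≤lies ⊥ v∈)
        lies-T = subst₂ (λ t u → mismatch a₀ t + (mismatch c u + mismatch d u) ≤ lies T)
                   (truth-⊤ (y , y∈T)) (truth-⁅⁆-∈ y∈T) (head+ballot≤lies T v∈)
    in contradiction (≤-trans (≤-reflexive (sym (mismatches-against-false-and-true a₀ c d)))
                       (≤-trans (+-mono-≤ lies-⊥ lies-T) (+-mono-≤ ⊥-ok T-ok)))
         λ { (s≤s (s≤s ())) }

  unanimous-no⇒⊥-consistent : All (Unanimous false) votes → lies ⊥ ≤ 1
  unanimous-no⇒⊥-consistent all-no = begin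
    lies ⊥                                                    ≡⟨ lies≡ ⊥ ⟩
    mismatch a₀ (truth ⊤ ⊥) + sum (map (ballotLies ⊥) votes)  ≡⟨ cong (mismatch a₀ (truth ⊤ ⊥) +_) (sum-map-≡0 (All.map ballotLies⊥≡0 all-no)) ⟩
    mismatch a₀ (truth ⊤ ⊥) + 0                               ≡⟨ +-identityʳ _ ⟩
    mismatch a₀ (truth ⊤ ⊥)                                   ≤⟨ mismatch≤1 a₀ _ ⟩
    1                                                         ∎
    where
    open ≤-Reasoning
    ballotLies⊥≡0 : {v : Ballot n} → Unanimous false v → ballotLies ⊥ v ≡ 0
    ballotLies⊥≡0 {i , false , false} refl rewrite truth-⊥ ⁅ i ⁆ = refl

  split-vote⇒∈ : {j : Fin n} {a b : Bool} (T : Subset n) → All (¬_ ∘ Unanimous true) votes → ¬ lies ⊥ ≤ 1 →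
    (j , a , b) ∈ₗ votes → ¬ Unanimous false (j , a , b) → lies T ≤ 1 → j ∈ T
  split-vote⇒∈ {j} {a} {b} T no-yes ⊥-bad v∈ split T-ok with j ∈? T | nonempty? T
  ... | yes j∈T | _   = j∈T
  ... | no  _   | no  T-empty = contradiction (subst (λ S → lies S ≤ 1) (Empty-unique T-empty) T-ok) ⊥-bad
  ... | no  j∉T | yes (y , y∈T) =
    let c , d , w∈ = vote y
        lie-at-j = subst (λ t → 1 ≤ mismatch a t + mismatch b t) (sym (truth-⁅⁆-∉ j∉T))
                     (¬unanimous⇒1≤mismatches false split)
        lie-at-y = subst (λ t → 1 ≤ mismatch c t + mismatch d t) (sym (truth-⁅⁆-∈ y∈T))
                     (¬unanimous⇒1≤mismatches true (All.lookup no-yes w∈))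
    in contradiction (≤-trans (+-mono-≤ lie-at-j lie-at-y) (≤-trans (two-ballots≤lies T v∈ w∈ λ { refl → j∉T y∈T }) T-ok))
         λ { (s≤s ()) }

  decode : (∃ λ (x : Fin n) → ∀ T → lies T ≤ 1 → x ∈ T) ⊎ (∀ T → lies T ≤ 1 → Empty T)
  decode with any? (unanimous? true) votes
  ... | yes some-yes with find some-yes
  ...   | (i , _ , _) , v∈ , refl = inj₁ (i , λ T → unanimous-yes⇒∈ T v∈)
  decode | no no-yes with lies ⊥ ≤? 1
  ... | yes ⊥-ok = inj₂ λ T → ⊥-consistent⇒empty T ⊥-ok
  ... | no  ⊥-bad with all? (unanimous? false) votes
  ...   | yes all-no = contradiction (unanimous-no⇒⊥-consistent all-no) ⊥-bad
  ...   | no  ¬all-no with find (¬All⇒Any¬ (unanimous? false) votes ¬all-no)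
  ...     | (j , _ , _) , v∈ , split = inj₁ (j , λ T → split-vote⇒∈ T (¬Any⇒All¬ votes no-yes) ⊥-bad v∈ split)

witnessFamily-solves : (n : ℕ) → Solves (witnessFamily n)
witnessFamily-solves n (a₀ ∷ bs) = WitnessFamilyDecoding.decode a₀ bs

theorem2p1 : (n : ℕ) → 1 ≤ n →
    (∃ λ (𝓕 : Family n) → length 𝓕 ≡ 2 * n + 1 × Solves 𝓕)
    × (∀ (𝓕 : Family n) → Solves 𝓕 → 2 * n + 1 ≤ length 𝓕)
theorem2p1 n 1≤n =
  (witnessFamily n , length-witnessFamily n , witnessFamily-solves n) ,
  λ 𝓕 → solves⇒2n+1≤length 𝓕 1≤n
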